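{- If $\mathcal{A}$ is a $G$-small $G$-pathset and $\mathcal{B}$ is an $H$-small $H$-pathset (for pattern graphs $G,H$), then $\mathcal{A}\bowtie\mathcal{B}$ is a $(G\cup H)$-small $(G\cup H)$-pathset.
   Context: Integers $n\ge1$, $k\ge2$; logs base 2. $V_k=\{v_0,\dots,v_k\}$, $E_k=\{v_iv_{i+1}:0\le i<k\}$. A pattern graph is $G=(V_G,E_G)$ with $E_G\subseteq E_k$ and $V_G$ the endpoints of $E_G$; $c(G)$ its number of components; $G\cup H=(V_G\cup V_H,E_G\cup E_H)$. A $G$-pathset is a subset of $[n]^{V_G}$ (maps $V_G\to[n]$). For $\mathcal{A}\subseteq[n]^V$, $S\subseteq V$, $z\in[n]^{V\setminus S}$: $\mathcal{A}|^z_S=\{y\in[n]^S:yz\in\mathcal{A}\}$ ($yz$ the combined tuple) and $\mu_S(\mathcal{A})=\max_z|\mathcal{A}|^z_S|/n^{|S|}$. Join: $\mathcal{A}\bowtie\mathcal{B}=\{x\in[n]^{V\cup W}:x_V\in\mathcal{A},x_W\in\mathcal{B}\}$ for $\mathcal{A}\subseteq[n]^V$, $\mathcal{B}\subseteq[n]^W$. With $\varepsilon=1/\log k$, $\tilde n=n^{1-\varepsilon}$: $\mathcal{A}$ is $G$-small if $\mu_S(\mathcal{A})\le\tilde n^{ -t}$ for every $1\le t\le c(G)$ and every $S\subseteq V_G$ that is a union of $t$ components of $G$. -}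

module Defs where

open import Data.Nat using (ℕ; zero; suc; _+_; _*_; _^_; _≤_; _<_; _≡ᵇ_; _≤ᵇ_)
open import Data.Bool using (Bool; true; false; _∧_; _∨_; not; if_then_else_)
open import Data.Fin using (Fin; toℕ)
open import Data.Fin.Subset using (Subset; _∈_; _∉_; _∪_; ⊥)
open import Data.Vec using (lookup; tabulate)
import Data.Vec.Functional
open import Data.List using (List; []; _∷_; length; map; concatMap; foldr; allFin)
open import Data.Nat.ListAction using (sum)
open import Data.Bool.ListAction using (any; all)
open import Data.List.Relation.Unary.All using (All)
open import Data.List.Relation.Unary.AllPairs using (AllPairs)
open import Data.Product using (Σ; _×_)
open import Relation.Binary.PropositionalEquality using (_≡_; _≢_)

-- Path P_k : vertices v_0..v_k = Fin (suc k), edges e_i = v_i v_{i+1}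
-- indexed by i : Fin k.  A pattern graph G is given by its edge set
-- E_G ⊆ E_k; V_G is the set of endpoints of the edges of E_G.

PatternGraph : ℕ → Set
PatternGraph k = Subset k

endpoint : ∀ {k} → Fin k → Fin (suc k) → Bool
endpoint i v = (toℕ v ≡ᵇ toℕ i) ∨ (toℕ v ≡ᵇ suc (toℕ i))

vertices : ∀ {k} → PatternGraph k → Subset (suc k)
vertices {k} E = tabulate λ v → any (λ i → lookup E i ∧ endpoint i v) (allFin k)

-- G ∪ H (its vertex set is the endpoint set of E_G ∪ E_H = V_G ∪ V_H)
_∪G_ : ∀ {k} → PatternGraph k → PatternGraph k → PatternGraph k
G ∪G H = G ∪ H

interval : ∀ {k} → ℕ → ℕ → Subset (suc k)
interval a b = tabulate λ v → (a ≤ᵇ toℕ v) ∧ (toℕ v ≤ᵇ b)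

-- C is (the vertex set of) a connected component of G: a maximal run
-- of consecutive edges e_a, ..., e_{b-1} of G, with vertex set v_a..v_b.
IsComponent : ∀ {k} → PatternGraph k → Subset (suc k) → Set
IsComponent {k} E C =
  Σ ℕ λ a → Σ ℕ λ b →
    a < b × b ≤ k
    × (∀ (i : Fin k) → a ≤ toℕ i → toℕ i < b → i ∈ E)
    × (∀ (i : Fin k) → suc (toℕ i) ≡ a → i ∉ E)
    × (∀ (i : Fin k) → toℕ i ≡ b → i ∉ E)
    × C ≡ interval a b

UnionOfComponents : ∀ {k} → PatternGraph k → ℕ → Subset (suc k) → Set
UnionOfComponents {k} E t S =
  Σ (List (Subset (suc k))) λ Cs →
    length Cs ≡ t × All (IsComponent E) Cs × AllPairs _≢_ Cs
    × S ≡ foldr _∪_ ⊥ Cs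

-- c(G): number of components = number of maximal runs of edges
-- (counted by their first edge).
runs : ∀ {m} → Bool → Subset m → ℕ
runs prev Data.Vec.[] = 0
runs prev (b Data.Vec.∷ E) = (if b ∧ not prev then 1 else 0) + runs b E

c : ∀ {k} → PatternGraph k → ℕ
c E = runs false E

-- A map x : V_G → [n] is represented by a total map
-- Fin (suc k) → Fin n; a subset 𝒜 ⊆ [n]^{V_G} is represented by a
-- (decidable) predicate on such total maps that depends only on the
-- coordinates in V_G (a cylinder set).  This is a bijective encoding.

Asg : ℕ → ℕ → Set
Asg n k = Fin (suc k) → Fin n

DependsOn : ∀ {n k} → Subset (suc k) → (Asg n k → Bool) → Set
DependsOn {n} {k} V A =
  ∀ (x y : Asg n k) → (∀ v → v ∈ V → x v ≡ y v) → A x ≡ A y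

join : ∀ {n k} → (Asg n k → Bool) → (Asg n k → Bool) → Asg n k → Bool
join A B x = A x ∧ B x

allFuns : (n m : ℕ) → List (Fin m → Fin n)
allFuns n zero = (λ ()) ∷ []
allFuns n (suc m) = concatMap (λ a → map (λ f → a Data.Vec.Functional.∷ f) (allFuns n m)) (allFin n)

countTrue : ∀ {X : Set} → (X → Bool) → List X → ℕ
countTrue p xs = sum (map (λ x → if p x then 1 else 0) xs)

agreeOutside : ∀ {n k} → Subset (suc k) → Asg n k → Asg n k → Bool
agreeOutside {n} {k} S w x =
  all (λ v → lookup S v ∨ (toℕ (x v) ≡ᵇ toℕ (w v))) (allFin (suc k))

-- |𝒜|^z_S| where z = (restriction of w to V∖S):
-- the number of y ∈ [n]^S with yz ∈ 𝒜.
fiberSize : ∀ {n k} → (Asg n k → Bool) → Subset (suc k) → Asg n k → ℕ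
fiberSize {n} {k} A S w =
  countTrue (λ x → agreeOutside S w x ∧ A x) (allFuns n (suc k))

-- The real inequality  m / n^s ≤ ñ^{-t},  ñ = n^{1-ε}, ε = 1/log₂ k,
-- i.e.  m ≤ n^{s-t} · n^{t/log₂ k},  i.e.  (m/n^{s-t})^{log₂ k} ≤ n^t,
-- is encoded exactly in ℕ: it holds iff for every rational p/q < log₂ k
-- (i.e. 2^p < k^q, q ≥ 1) we have (m/n^{s-t})^{p/q} ≤ n^t, i.e.
--   m^p · n^{t p} ≤ n^{t q + s p}.
-- (Equivalence by monotonicity/continuity of r ↦ a^r.)
BoundLe : (n k s t m : ℕ) → Set
BoundLe n k s t m =
  ∀ (p q : ℕ) → 1 ≤ q → 2 ^ p < k ^ q → m ^ p * n ^ (t * p) ≤ n ^ (t * q + s * p)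

-- 𝒜 is G-small: μ_S(𝒜) ≤ ñ^{-t} for all 1 ≤ t ≤ c(G) and all S that
-- are unions of t components of G (max over z = all w).
Small : (n k : ℕ) → PatternGraph k → (Asg n k → Bool) → Set
Small n k G A =
  ∀ (t : ℕ) → 1 ≤ t → t ≤ c G →
  ∀ (S : Subset (suc k)) → UnionOfComponents G t S →
  ∀ (w : Asg n k) → BoundLe n k (Data.Fin.Subset.∣ S ∣) t (fiberSize A S w)

module Submission where

-- Let S be the union of t distinct components of G ∪ H.  A component of G ∪ H that
-- contains an edge of G contains a whole component of G (the run of G-edges starting at
-- its first G-edge); any other one is a component of H, and it avoids V_G because its two
-- neighbouring edges are not in G either.  So S contains t₁ distinct components of G with
-- union S₁ ⊆ V_G and t₂ distinct components of H with union S₂ disjoint from V_G, where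
-- t₁ + t₂ = t.  Write S = R ⊎ S₁ ⊎ S₂ and count a fiber of A ⋈ B over S block by block:
-- A does not read the coordinates in S₂, so the sum over S₂ is at most [A] times the
-- largest B-fiber over S₂, the sum over S₁ then brings in the largest A-fiber over S₁,
-- and R contributes n^|R|.  Normalising, μ_S(A ⋈ B) ≤ μ_{S₁}(A) μ_{S₂}(B) ≤ ñ^-t₁ ñ^-t₂,
-- and in the integer form BoundLe of these inequalities the exponents just add up.

open import Data.Bool using (Bool; true; false; T; _∧_; _∨_; not; if_then_else_)
open import Data.Bool.ListAction using (all; and; any)
open import Data.Bool.Properties
  using (T-≡; T-∧; T-∨; ∨-conicalˡ; ∨-conicalʳ; ¬-not; not-injective; if-∧)
open import Data.Empty using (⊥)
open import Data.Fin using (Fin; zero; suc; toℕ; fromℕ<)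
open import Data.Fin.Properties using (toℕ-fromℕ<)
open import Data.Fin.Subset
  using (Subset; inside; outside; _∈_; _∉_; _⊆_; _∪_; _─_; _-_; ⋃; ∣_∣; Nonempty)
open import Data.Fin.Subset.Properties
  using (x∈p∪q⁻; p⊆p∪q; q⊆p∪q; ∉⊥; drop-∷-⊆; x∈p⇒∣p-x∣<∣p∣; x∈p∧x≢y⇒x∈p-y)
open import Data.List using (List; []; _∷_; _++_; map; concatMap; tabulate; allFin; length)
open import Data.List.Extrema.Nat using (max; v≤max⁺; argmax-all)
open import Data.List.Properties using (map-tabulate; map-∘; map-cong; map-++)
open import Data.List.Relation.Unary.All as All using (All; []; _∷_)
import Data.List.Relation.Unary.All.Properties as All
open import Data.List.Relation.Unary.AllPairs using (AllPairs; []; _∷_)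
open import Data.List.Relation.Unary.Any as Any using (Any)
import Data.List.Relation.Unary.Any.Properties as Any
open import Data.Nat using (ℕ; zero; suc; _+_; _*_; _^_; _≤_; _<_; _≤?_; _≤ᵇ_; _≡ᵇ_; z≤n; s≤s)
open import Data.Nat.ListAction using (sum)
open import Data.Nat.ListAction.Properties using (sum-++)
open import Data.Nat.Properties
open import Data.Nat.Solver using (module +-*-Solver)
open import Algebra.Properties.Semiring.Sum +-*-semiring
  using (sum-syntax; sum-cong-≗; sum-replicate-zero; ∑-comm; *-distribˡ-sum)
open import Data.Product using (∃; ∃₂; _×_; _,_)
open import Data.Sum as Sum using (_⊎_; inj₁; inj₂; [_,_]′)
open import Data.Vec using ([]; _∷_; here; there; lookup)
open import Data.Vec.Functional using (head; tail) renaming (_∷_ to _∷ᶠ_)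
open import Data.Vec.Properties using (lookup∘tabulate; []=⇒lookup; lookup⇒[]=)
open import Defs
open import Function using (_∘_; const; id; Equivalence)
open import Relation.Binary.Definitions using (tri<; tri≈; tri>)
open import Relation.Binary.PropositionalEquality
open import Relation.Nullary using (contradiction; yes; no)

-- Subsets

∈⇒T : ∀ {m} {p : Subset m} {x} → x ∈ p → T (lookup p x)
∈⇒T x∈p = Equivalence.from T-≡ ([]=⇒lookup x∈p)

T⇒∈ : ∀ {m} {p : Subset m} {x} → T (lookup p x) → x ∈ p
T⇒∈ {p = p} {x} t = lookup⇒[]= x p (Equivalence.to T-≡ t)

Disjoint : ∀ {m} → Subset m → Subset m → Set
Disjoint p q = ∀ {x} → x ∈ p → x ∉ q

drop-∷-Disjoint : ∀ {m s t} {p q : Subset m} → Disjoint (s ∷ p) (t ∷ q) → Disjoint p q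
drop-∷-Disjoint p∩q=∅ x∈p x∈q = p∩q=∅ (there x∈p) (there x∈q)

∪-⊆ : ∀ {m} {p q r : Subset m} → p ⊆ r → q ⊆ r → p ∪ q ⊆ r
∪-⊆ {p = p} {q} p⊆r q⊆r x∈p∪q = [ p⊆r , q⊆r ]′ (x∈p∪q⁻ p q x∈p∪q)

∪-mono-⊆ : ∀ {m} {p p′ q q′ : Subset m} → p ⊆ p′ → q ⊆ q′ → p ∪ q ⊆ p′ ∪ q′
∪-mono-⊆ {p′ = p′} {q′ = q′} p⊆p′ q⊆q′ =
  ∪-⊆ (λ x∈p → p⊆p∪q q′ (p⊆p′ x∈p)) (λ x∈q → q⊆p∪q p′ q′ (q⊆q′ x∈q))

∪-Disjoint : ∀ {m} {p q r : Subset m} → Disjoint p r → Disjoint q r → Disjoint (p ∪ q) r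
∪-Disjoint {p = p} {q} p∩r=∅ q∩r=∅ x∈p∪q = [ p∩r=∅ , q∩r=∅ ]′ (x∈p∪q⁻ p q x∈p∪q)

Disjoint-⋃ : ∀ {m} {C : Subset m} {Cs} → All (Disjoint C) Cs → Disjoint C (⋃ Cs)
Disjoint-⋃ []                              x∈C x∈⊥    = ∉⊥ x∈⊥
Disjoint-⋃ {Cs = D ∷ Ds} (C∩D=∅ ∷ C∩Ds=∅) x∈C x∈D∪Ds =
  [ C∩D=∅ x∈C , Disjoint-⋃ C∩Ds=∅ x∈C ]′ (x∈p∪q⁻ D (⋃ Ds) x∈D∪Ds)

Disjoint-⋃⇒distinct : ∀ {m} {D : Subset m} {Ds} → Nonempty D → Disjoint D (⋃ Ds) → All (D ≢_) Ds
Disjoint-⋃⇒distinct {Ds = []}      _         _       = []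
Disjoint-⋃⇒distinct {Ds = D′ ∷ Ds} (x , x∈D) D∩⋃=∅ =
  (λ { refl → D∩⋃=∅ x∈D (p⊆p∪q (⋃ Ds) x∈D) }) ∷
  Disjoint-⋃⇒distinct (x , x∈D) (λ y∈D y∈⋃Ds → D∩⋃=∅ y∈D (q⊆p∪q D′ (⋃ Ds) y∈⋃Ds))

─-Disjoint : ∀ {m} (p q : Subset m) → Disjoint (p ─ q) q
─-Disjoint (s ∷ p) (inside  ∷ q) (there x∈p─q) (there x∈q) = ─-Disjoint p q x∈p─q x∈q
─-Disjoint (s ∷ p) (outside ∷ q) (there x∈p─q) (there x∈q) = ─-Disjoint p q x∈p─q x∈q

─-∪ : ∀ {m} {p q : Subset m} → q ⊆ p → (p ─ q) ∪ q ≡ p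
─-∪ {p = []}          {[]}          _   = refl
─-∪ {p = s ∷ p}       {inside  ∷ q} q⊆p with q⊆p here
... | here = cong (inside ∷_) (─-∪ (drop-∷-⊆ q⊆p))
─-∪ {p = inside  ∷ p} {outside ∷ q} q⊆p = cong (inside ∷_) (─-∪ (drop-∷-⊆ q⊆p))
─-∪ {p = outside ∷ p} {outside ∷ q} q⊆p = cong (outside ∷_) (─-∪ (drop-∷-⊆ q⊆p))

∣p∪q∣≡∣p∣+∣q∣ : ∀ {m} (p q : Subset m) → Disjoint p q → ∣ p ∪ q ∣ ≡ ∣ p ∣ + ∣ q ∣
∣p∪q∣≡∣p∣+∣q∣ []            []            _     = refl
∣p∪q∣≡∣p∣+∣q∣ (inside  ∷ p) (inside  ∷ q) p∩q=∅ = contradiction here (p∩q=∅ here)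
∣p∪q∣≡∣p∣+∣q∣ (inside  ∷ p) (outside ∷ q) p∩q=∅ =
  cong suc (∣p∪q∣≡∣p∣+∣q∣ p q (drop-∷-Disjoint p∩q=∅))
∣p∪q∣≡∣p∣+∣q∣ (outside ∷ p) (inside  ∷ q) p∩q=∅ =
  trans (cong suc (∣p∪q∣≡∣p∣+∣q∣ p q (drop-∷-Disjoint p∩q=∅))) (sym (+-suc ∣ p ∣ ∣ q ∣))
∣p∪q∣≡∣p∣+∣q∣ (outside ∷ p) (outside ∷ q) p∩q=∅ = ∣p∪q∣≡∣p∣+∣q∣ p q (drop-∷-Disjoint p∩q=∅)

length≤∣p∣ : ∀ {A : Set} {m} (R : A → Fin m → Set) → (∀ {x y i} → R x i → R y i → x ≡ y) →
  ∀ {p : Subset m} {xs} → All (λ x → ∃ λ i → i ∈ p × R x i) xs → AllPairs _≢_ xs → length xs ≤ ∣ p ∣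
length≤∣p∣ R R-injective [] [] = z≤n
length≤∣p∣ R R-injective {p} {x ∷ _} ((i , i∈p , Rxi) ∷ labelled) (x≢xs ∷ distinct) = ≤-trans
  (s≤s (length≤∣p∣ R R-injective (All.zipWith relabel (x≢xs , labelled)) distinct))
  (x∈p⇒∣p-x∣<∣p∣ i∈p)
  where
  relabel : ∀ {y} → x ≢ y × (∃ λ j → j ∈ p × R y j) → ∃ λ j → j ∈ p - i × R y j
  relabel (x≢y , j , j∈p , Ryj) = j , x∈p∧x≢y⇒x∈p-y j∈p (λ { refl → x≢y (R-injective Rxi Ryj) }) , Ryj

-- Finite sums

∑-mono : ∀ {m} {f g : Fin m → ℕ} → (∀ i → f i ≤ g i) → ∑[ i < m ] f i ≤ ∑[ i < m ] g i
∑-mono {zero}  f≤g = z≤n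
∑-mono {suc m} f≤g = +-mono-≤ (f≤g zero) (∑-mono (f≤g ∘ suc))

∑-const : ∀ m c → ∑[ i < m ] c ≡ m * c
∑-const zero    c = refl
∑-const (suc m) c = cong (c +_) (∑-const m c)

∑-δ : ∀ {m} (j : Fin m) (f : Fin m → ℕ) → ∑[ i < m ] (if toℕ i ≡ᵇ toℕ j then f i else 0) ≡ f j
∑-δ {suc m} zero    f = trans (cong (f zero +_) (sum-replicate-zero m)) (+-identityʳ (f zero))
∑-δ         (suc j) f = ∑-δ j (f ∘ suc)

sum-tabulate : ∀ {m} (f : Fin m → ℕ) → sum (tabulate f) ≡ ∑[ i < m ] f i
sum-tabulate {zero}  f = refl
sum-tabulate {suc m} f = cong (f zero +_) (sum-tabulate (f ∘ suc))

sum-map-concatMap : ∀ {A B : Set} (h : B → ℕ) (g : A → List B) xs →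
  sum (map h (concatMap g xs)) ≡ sum (map (sum ∘ map h ∘ g) xs)
sum-map-concatMap h g []       = refl
sum-map-concatMap h g (x ∷ xs) = begin
  sum (map h (g x ++ concatMap g xs))              ≡⟨ cong sum (map-++ h (g x) _) ⟩
  sum (map h (g x) ++ map h (concatMap g xs))      ≡⟨ sum-++ (map h (g x)) _ ⟩
  sum (map h (g x)) + sum (map h (concatMap g xs)) ≡⟨ cong (_ +_) (sum-map-concatMap h g xs) ⟩
  sum (map (sum ∘ map h ∘ g) (x ∷ xs))             ∎
  where open ≡-Reasoning

sum-map-if : ∀ {A : Set} b (g : A → ℕ) xs →
  sum (map (λ x → if b then g x else 0) xs) ≡ (if b then sum (map g xs) else 0)
sum-map-if true  g xs       = refl
sum-map-if false g []       = refl
sum-map-if false g (x ∷ xs) = sum-map-if false g xs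

sum-allFuns-suc : ∀ {n m} (h : (Fin (suc m) → Fin n) → ℕ) →
  sum (map h (allFuns n (suc m))) ≡ ∑[ a < n ] sum (map (h ∘ (a ∷ᶠ_)) (allFuns n m))
sum-allFuns-suc {n} {m} h = begin
  sum (map h (allFuns n (suc m)))
    ≡⟨ sum-map-concatMap h (λ a → map (a ∷ᶠ_) (allFuns n m)) (allFin n) ⟩
  sum (map g (allFin n))  ≡⟨ cong sum (map-tabulate id g) ⟩
  sum (tabulate g)        ≡⟨ sum-tabulate g ⟩
  ∑[ a < n ] g a          ≡⟨ sum-cong-≗ {n} (λ a → cong sum (map-∘ (allFuns n m))) ⟨
  ∑[ a < n ] sum (map (h ∘ (a ∷ᶠ_)) (allFuns n m)) ∎
  where
  open ≡-Reasoning
  g : Fin n → ℕ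
  g a = sum (map h (map (a ∷ᶠ_) (allFuns n m)))

-- Sums over fibers

Extensional : ∀ {m n} {B : Set} → ((Fin m → Fin n) → B) → Set
Extensional f = ∀ {x y} → (∀ i → x i ≡ y i) → f x ≡ f y

∷-Extensional : ∀ {m n} {B : Set} {f : (Fin (suc m) → Fin n) → B} a →
  Extensional f → Extensional (f ∘ (a ∷ᶠ_))
∷-Extensional a f-ext x≗y = f-ext λ { zero → refl ; (suc i) → x≗y i }

AgreeOutside : ∀ {n m} → Subset m → (Fin m → Fin n) → (Fin m → Fin n) → Set
AgreeOutside S w x = ∀ {v} → v ∉ S → x v ≡ w v

module _ {n : ℕ} where

  -- fiberSum S w f is the sum of f (y z) over y ∈ [n]^S, z being w restricted to the rest.
  fiberSum : ∀ {m} → Subset m → (Fin m → Fin n) → ((Fin m → Fin n) → ℕ) → ℕ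
  fiberSum []            w f = f λ ()
  fiberSum (inside  ∷ S) w f = ∑[ a < n ] fiberSum S (tail w) (f ∘ (a ∷ᶠ_))
  fiberSum (outside ∷ S) w f = fiberSum S (tail w) (f ∘ (head w ∷ᶠ_))

  private
    inside∷-AgreeOutside : ∀ {m} {S : Subset m} (w : Fin (suc m) → Fin n) {x a} →
      AgreeOutside S (tail w) x → AgreeOutside (inside ∷ S) w (a ∷ᶠ x)
    inside∷-AgreeOutside w agree {zero}  0∉S = contradiction here 0∉S
    inside∷-AgreeOutside w agree {suc v} v∉S = agree (v∉S ∘ there)

    outside∷-AgreeOutside : ∀ {m} {S : Subset m} (w : Fin (suc m) → Fin n) {x} →
      AgreeOutside S (tail w) x → AgreeOutside (outside ∷ S) w (head w ∷ᶠ x)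
    outside∷-AgreeOutside w agree {zero}  _   = refl
    outside∷-AgreeOutside w agree {suc v} v∉S = agree (v∉S ∘ there)

  fiberSum-mono : ∀ {m} (S : Subset m) (w : Fin m → Fin n) {f g : (Fin m → Fin n) → ℕ} →
    (∀ x → AgreeOutside S w x → f x ≤ g x) → fiberSum S w f ≤ fiberSum S w g
  fiberSum-mono []            w f≤g = f≤g _ λ { {()} }
  fiberSum-mono (inside  ∷ S) w f≤g = ∑-mono λ a →
    fiberSum-mono S (tail w) λ x agree → f≤g (a ∷ᶠ x) (inside∷-AgreeOutside w agree)
  fiberSum-mono (outside ∷ S) w f≤g =
    fiberSum-mono S (tail w) λ x agree → f≤g (head w ∷ᶠ x) (outside∷-AgreeOutside w agree)

  fiberSum-cong : ∀ {m} (S : Subset m) (w : Fin m → Fin n) {f g : (Fin m → Fin n) → ℕ} →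
    (∀ x → AgreeOutside S w x → f x ≡ g x) → fiberSum S w f ≡ fiberSum S w g
  fiberSum-cong S w f≡g = ≤-antisym
    (fiberSum-mono S w λ x agree → ≤-reflexive (f≡g x agree))
    (fiberSum-mono S w λ x agree → ≤-reflexive (sym (f≡g x agree)))

  fiberSum-congʷ : ∀ {m} (S : Subset m) {w w′ : Fin m → Fin n} (f : (Fin m → Fin n) → ℕ) →
    (∀ i → w i ≡ w′ i) → fiberSum S w f ≡ fiberSum S w′ f
  fiberSum-congʷ []            f w≗w′ = refl
  fiberSum-congʷ (inside  ∷ S) f w≗w′ =
    sum-cong-≗ λ a → fiberSum-congʷ S (f ∘ (a ∷ᶠ_)) (w≗w′ ∘ suc)
  fiberSum-congʷ (outside ∷ S) {w} {w′} f w≗w′ rewrite w≗w′ zero =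
    fiberSum-congʷ S (f ∘ (w′ zero ∷ᶠ_)) (w≗w′ ∘ suc)

  fiberSum-const : ∀ {m} (S : Subset m) (w : Fin m → Fin n) c → fiberSum S w (const c) ≡ n ^ ∣ S ∣ * c
  fiberSum-const []            w c = sym (+-identityʳ c)
  fiberSum-const (inside  ∷ S) w c = begin
    ∑[ a < n ] fiberSum S (tail w) (const c) ≡⟨ sum-cong-≗ {n} (λ _ → fiberSum-const S (tail w) c) ⟩
    ∑[ a < n ] (n ^ ∣ S ∣ * c)               ≡⟨ ∑-const n _ ⟩
    n * (n ^ ∣ S ∣ * c)                      ≡⟨ *-assoc n _ c ⟨
    n ^ ∣ inside ∷ S ∣ * c                   ∎
    where open ≡-Reasoning
  fiberSum-const (outside ∷ S) w c = fiberSum-const S (tail w) c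

  fiberSum-*ˡ : ∀ {m} (S : Subset m) (w : Fin m → Fin n) c f →
    fiberSum S w (λ x → c * f x) ≡ c * fiberSum S w f
  fiberSum-*ˡ []            w c f = refl
  fiberSum-*ˡ (inside  ∷ S) w c f = trans
    (sum-cong-≗ {n} λ a → fiberSum-*ˡ S (tail w) c (f ∘ (a ∷ᶠ_)))
    (sym (*-distribˡ-sum c λ a → fiberSum S (tail w) (f ∘ (a ∷ᶠ_))))
  fiberSum-*ˡ (outside ∷ S) w c f = fiberSum-*ˡ S (tail w) c (f ∘ (head w ∷ᶠ_))

  fiberSum-∑ : ∀ {m} (S : Subset m) (w : Fin m → Fin n) (g : Fin n → (Fin m → Fin n) → ℕ) →
    fiberSum S w (λ x → ∑[ a < n ] g a x) ≡ ∑[ a < n ] fiberSum S w (g a)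
  fiberSum-∑ []            w g = refl
  fiberSum-∑ (inside  ∷ S) w g = trans
    (sum-cong-≗ λ b → fiberSum-∑ S (tail w) λ a x → g a (b ∷ᶠ x))
    (∑-comm λ b a → fiberSum S (tail w) (g a ∘ (b ∷ᶠ_)))
  fiberSum-∑ (outside ∷ S) w g = fiberSum-∑ S (tail w) λ a x → g a (head w ∷ᶠ x)

  fiberSum-∪ : ∀ {m} (S T : Subset m) (w : Fin m → Fin n) f → Disjoint S T →
    fiberSum (S ∪ T) w f ≡ fiberSum S w (λ u → fiberSum T u f)
  fiberSum-∪ []            []            w f S∩T=∅ = refl
  fiberSum-∪ (inside  ∷ S) (inside  ∷ T) w f S∩T=∅ = contradiction here (S∩T=∅ here)
  fiberSum-∪ (inside  ∷ S) (outside ∷ T) w f S∩T=∅ =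
    sum-cong-≗ λ a → fiberSum-∪ S T (tail w) (f ∘ (a ∷ᶠ_)) (drop-∷-Disjoint S∩T=∅)
  fiberSum-∪ (outside ∷ S) (inside  ∷ T) w f S∩T=∅ = trans
    (sum-cong-≗ λ a → fiberSum-∪ S T (tail w) (f ∘ (a ∷ᶠ_)) (drop-∷-Disjoint S∩T=∅))
    (sym (fiberSum-∑ S (tail w) λ a u → fiberSum T u (f ∘ (a ∷ᶠ_))))
  fiberSum-∪ (outside ∷ S) (outside ∷ T) w f S∩T=∅ =
    fiberSum-∪ S T (tail w) (f ∘ (head w ∷ᶠ_)) (drop-∷-Disjoint S∩T=∅)

indicator : Bool → ℕ
indicator b = if b then 1 else 0

indicator-∧ : ∀ a b → indicator (a ∧ b) ≡ indicator a * indicator b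
indicator-∧ true  b = sym (+-identityʳ (indicator b))
indicator-∧ false b = refl

-- agreeOutside of Defs, for tuples of any length, so that it can be unfolded coordinatewise.
agreeOutside′ : ∀ {n m} → Subset m → (Fin m → Fin n) → (Fin m → Fin n) → Bool
agreeOutside′ {m = m} S w x = all (λ v → lookup S v ∨ (toℕ (x v) ≡ᵇ toℕ (w v))) (allFin m)

agreeOutside′-∷ : ∀ {n m} s (S : Subset m) (w : Fin (suc m) → Fin n) a x →
  agreeOutside′ (s ∷ S) w (a ∷ᶠ x) ≡ (s ∨ (toℕ a ≡ᵇ toℕ (head w))) ∧ agreeOutside′ S (tail w) x
agreeOutside′-∷ s S w a x =
  cong (_ ∧_) (cong and (trans (map-tabulate suc p) (sym (map-tabulate id (p ∘ suc)))))
  where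
  p = λ v → lookup (s ∷ S) v ∨ (toℕ ((a ∷ᶠ x) v) ≡ᵇ toℕ (w v))

sumWhere : ∀ {n m} → ((Fin m → Fin n) → Bool) → ((Fin m → Fin n) → ℕ) → ℕ
sumWhere {n} {m} p f = sum (map (λ x → if p x then f x else 0) (allFuns n m))

sumWhere-cong : ∀ {n m} {p q : (Fin m → Fin n) → Bool} f → (∀ x → p x ≡ q x) → sumWhere p f ≡ sumWhere q f
sumWhere-cong {n} {m} f p≗q =
  cong sum (map-cong (λ x → cong (λ b → if b then f x else 0) (p≗q x)) (allFuns n m))

sumWhere-∧ : ∀ {n m} b (p : (Fin m → Fin n) → Bool) f →
  sumWhere (λ x → b ∧ p x) f ≡ (if b then sumWhere p f else 0)
sumWhere-∧ {n} {m} b p f =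
  trans (cong sum (map-cong (λ x → if-∧ b) (allFuns n m))) (sum-map-if b _ (allFuns n m))

sumWhere-agreeOutside′ : ∀ {n m} (S : Subset m) (w : Fin m → Fin n) f → Extensional f →
  sumWhere (agreeOutside′ S w) f ≡ fiberSum S w f
sumWhere-agreeOutside′ []      w f f-ext = trans (+-identityʳ _) (f-ext λ ())
sumWhere-agreeOutside′ {n} (s ∷ S) w f f-ext = begin
  sumWhere (agreeOutside′ (s ∷ S) w) f
    ≡⟨ sum-allFuns-suc (λ x → if agreeOutside′ (s ∷ S) w x then f x else 0) ⟩
  ∑[ a < n ] sumWhere (agreeOutside′ (s ∷ S) w ∘ (a ∷ᶠ_)) (f ∘ (a ∷ᶠ_))
    ≡⟨ sum-cong-≗ {n} sum-over-tail ⟩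
  ∑[ a < n ] (if s ∨ (toℕ a ≡ᵇ toℕ (head w)) then fiberSum S (tail w) (f ∘ (a ∷ᶠ_)) else 0)
    ≡⟨ sum-over-head s ⟩
  fiberSum (s ∷ S) w f ∎
  where
  open ≡-Reasoning
  sum-over-tail : ∀ a → sumWhere (agreeOutside′ (s ∷ S) w ∘ (a ∷ᶠ_)) (f ∘ (a ∷ᶠ_))
    ≡ (if s ∨ (toℕ a ≡ᵇ toℕ (head w)) then fiberSum S (tail w) (f ∘ (a ∷ᶠ_)) else 0)
  sum-over-tail a = begin
    sumWhere (agreeOutside′ (s ∷ S) w ∘ (a ∷ᶠ_)) (f ∘ (a ∷ᶠ_))
      ≡⟨ sumWhere-cong (f ∘ (a ∷ᶠ_)) (agreeOutside′-∷ s S w a) ⟩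
    sumWhere (λ x → (s ∨ e) ∧ agreeOutside′ S (tail w) x) (f ∘ (a ∷ᶠ_))
      ≡⟨ sumWhere-∧ (s ∨ e) (agreeOutside′ S (tail w)) (f ∘ (a ∷ᶠ_)) ⟩
    (if s ∨ e then sumWhere (agreeOutside′ S (tail w)) (f ∘ (a ∷ᶠ_)) else 0)
      ≡⟨ cong (λ z → if s ∨ e then z else 0)
              (sumWhere-agreeOutside′ S (tail w) (f ∘ (a ∷ᶠ_)) (∷-Extensional a f-ext)) ⟩
    (if s ∨ e then fiberSum S (tail w) (f ∘ (a ∷ᶠ_)) else 0) ∎
    where e = toℕ a ≡ᵇ toℕ (head w)
  sum-over-head : ∀ s →
    ∑[ a < n ] (if s ∨ (toℕ a ≡ᵇ toℕ (head w)) then fiberSum S (tail w) (f ∘ (a ∷ᶠ_)) else 0)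
    ≡ fiberSum (s ∷ S) w f
  sum-over-head inside  = refl
  sum-over-head outside = ∑-δ (head w) λ a → fiberSum S (tail w) (f ∘ (a ∷ᶠ_))

fiberSize≡fiberSum : ∀ {n k} (A : Asg n k → Bool) → Extensional A → ∀ S w →
  fiberSize A S w ≡ fiberSum S w (indicator ∘ A)
fiberSize≡fiberSum {n} {k} A A-ext S w = trans
  (cong sum (map-cong (λ x → if-∧ (agreeOutside S w x)) (allFuns n (suc k))))
  (sumWhere-agreeOutside′ S w (indicator ∘ A) (cong indicator ∘ A-ext))

allFuns-complete : ∀ {n m} (u : Fin m → Fin n) → Any (λ x → ∀ i → x i ≡ u i) (allFuns n m)
allFuns-complete {m = zero}  u = Any.here λ ()
allFuns-complete {m = suc m} u = Any.concat⁺ (Any.map⁺ (Any.tabulate⁺ (u zero) (Any.map⁺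
  (Any.map (λ x≗tail-u → λ { zero → refl ; (suc i) → x≗tail-u i }) (allFuns-complete (tail u))))))

maxOver : ∀ {n m} → ((Fin m → Fin n) → ℕ) → ℕ
maxOver {n} {m} g = max 0 (map g (allFuns n m))

≤maxOver : ∀ {n m} (g : (Fin m → Fin n) → ℕ) → Extensional g → ∀ u → g u ≤ maxOver g
≤maxOver g g-ext u = v≤max⁺ 0 _ (inj₂ (Any.map⁺
  (Any.map (λ x≗u → ≤-reflexive (g-ext (sym ∘ x≗u))) (allFuns-complete u))))

maxOver-all : ∀ {n m} (P : ℕ → Set) (g : (Fin m → Fin n) → ℕ) → P 0 → (∀ u → P (g u)) → P (maxOver g)
maxOver-all {n} {m} P g P0 Pg = argmax-all id {P = P} P0 (All.map⁺ (All.universal Pg (allFuns n m)))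

-- The exponent bound

^-distrib-* : ∀ x y p → (x * y) ^ p ≡ x ^ p * y ^ p
^-distrib-* x y zero    = refl
^-distrib-* x y (suc p) = begin
  x * y * (x * y) ^ p      ≡⟨ cong (x * y *_) (^-distrib-* x y p) ⟩
  x * y * (x ^ p * y ^ p)  ≡⟨ solve 4 (λ x y X Y → (x :* y) :* (X :* Y) := (x :* X) :* (y :* Y))
                                       refl x y (x ^ p) (y ^ p) ⟩
  x * x ^ p * (y * y ^ p)  ∎
  where
  open ≡-Reasoning
  open +-*-Solver

BoundLe-0 : ∀ {n} k s t → 1 ≤ n → BoundLe n k s t 0
BoundLe-0 {n} k s t 1≤n zero q _ _ = begin
  1 * n ^ (t * 0)      ≡⟨ cong (λ e → 1 * n ^ e) (*-zeroʳ t) ⟩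
  1                    ≡⟨ ^-zeroˡ (t * q + s * 0) ⟨
  1 ^ (t * q + s * 0)  ≤⟨ ^-monoˡ-≤ (t * q + s * 0) 1≤n ⟩
  n ^ (t * q + s * 0)  ∎
  where open ≤-Reasoning
BoundLe-0 k s t 1≤n (suc p) q _ _ = z≤n

BoundLe-n^s : ∀ n k s → BoundLe n k s 0 (n ^ s)
BoundLe-n^s n k s p q _ _ = ≤-reflexive (trans (*-identityʳ _) (^-*-assoc n s p))

BoundLe-* : ∀ {n k r s₁ s₂ t₁ t₂ m α β} → m ≤ n ^ r * (α * β) →
  BoundLe n k s₁ t₁ α → BoundLe n k s₂ t₂ β → BoundLe n k (r + (s₁ + s₂)) (t₁ + t₂) m
BoundLe-* {n} {k} {r} {s₁} {s₂} {t₁} {t₂} {m} {α} {β} m≤ α-bounded β-bounded p q 1≤q 2^p<k^q = begin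
  m ^ p * n ^ ((t₁ + t₂) * p)
    ≤⟨ *-monoˡ-≤ (n ^ ((t₁ + t₂) * p)) (^-monoˡ-≤ p m≤) ⟩
  (n ^ r * (α * β)) ^ p * n ^ ((t₁ + t₂) * p)
    ≡⟨ cong₂ _*_ (trans (^-distrib-* (n ^ r) (α * β) p) (cong ((n ^ r) ^ p *_) (^-distrib-* α β p)))
                 (trans (cong (n ^_) (*-distribʳ-+ p t₁ t₂)) (^-distribˡ-+-* n (t₁ * p) (t₂ * p))) ⟩
  (n ^ r) ^ p * (α ^ p * β ^ p) * (n ^ (t₁ * p) * n ^ (t₂ * p))
    ≡⟨ solve 5 (λ R A B X Y → R :* (A :* B) :* (X :* Y) := R :* ((A :* X) :* (B :* Y))) refl
         ((n ^ r) ^ p) (α ^ p) (β ^ p) (n ^ (t₁ * p)) (n ^ (t₂ * p)) ⟩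
  (n ^ r) ^ p * ((α ^ p * n ^ (t₁ * p)) * (β ^ p * n ^ (t₂ * p)))
    ≤⟨ *-monoʳ-≤ ((n ^ r) ^ p) (*-mono-≤ (α-bounded p q 1≤q 2^p<k^q) (β-bounded p q 1≤q 2^p<k^q)) ⟩
  (n ^ r) ^ p * (n ^ (t₁ * q + s₁ * p) * n ^ (t₂ * q + s₂ * p))
    ≡⟨ cong₂ _*_ (^-*-assoc n r p) (sym (^-distribˡ-+-* n (t₁ * q + s₁ * p) (t₂ * q + s₂ * p))) ⟩
  n ^ (r * p) * n ^ ((t₁ * q + s₁ * p) + (t₂ * q + s₂ * p))
    ≡⟨ ^-distribˡ-+-* n (r * p) _ ⟨
  n ^ (r * p + ((t₁ * q + s₁ * p) + (t₂ * q + s₂ * p)))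
    ≡⟨ cong (n ^_) (solve 7 (λ r s₁ s₂ t₁ t₂ p q →
         r :* p :+ ((t₁ :* q :+ s₁ :* p) :+ (t₂ :* q :+ s₂ :* p))
           := (t₁ :+ t₂) :* q :+ (r :+ (s₁ :+ s₂)) :* p) refl r s₁ s₂ t₁ t₂ p q) ⟩
  n ^ ((t₁ + t₂) * q + (r + (s₁ + s₂)) * p) ∎
  where
  open ≤-Reasoning
  open +-*-Solver

-- Runs of edges on the path

true≢false : true ≢ false
true≢false ()

-- Whether e_j = v_j v_{j+1} is in E; false for j ≥ k, where there is no edge e_j.
edgeAt : ∀ {k} → Subset k → ℕ → Bool
edgeAt []      j       = false
edgeAt (s ∷ E) zero    = s
edgeAt (s ∷ E) (suc j) = edgeAt E j

edgeAt-toℕ : ∀ {k} (E : Subset k) i → edgeAt E (toℕ i) ≡ lookup E i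
edgeAt-toℕ (s ∷ E) zero    = refl
edgeAt-toℕ (s ∷ E) (suc i) = edgeAt-toℕ E i

edgeAt-≥ : ∀ {k} (E : Subset k) {j} → k ≤ j → edgeAt E j ≡ false
edgeAt-≥ []      k≤j       = refl
edgeAt-≥ (s ∷ E) (s≤s k≤j) = edgeAt-≥ E k≤j

edgeAt-∪ : ∀ {k} (G H : Subset k) j → edgeAt (G ∪ H) j ≡ edgeAt G j ∨ edgeAt H j
edgeAt-∪ []      []      j       = refl
edgeAt-∪ (s ∷ G) (t ∷ H) zero    = refl
edgeAt-∪ (s ∷ G) (t ∷ H) (suc j) = edgeAt-∪ G H j

∈⇒edgeAt : ∀ {k} {E : Subset k} {i} → i ∈ E → edgeAt E (toℕ i) ≡ true
∈⇒edgeAt {E = E} i∈E = trans (edgeAt-toℕ E _) ([]=⇒lookup i∈E)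

edgeAt⇒∉ : ∀ {k} {E : Subset k} {i} → edgeAt E (toℕ i) ≡ false → i ∉ E
edgeAt⇒∉ e i∈E = true≢false (trans (sym (∈⇒edgeAt i∈E)) e)

edgeAt⇒∈ : ∀ {k} {E : Subset k} {j} (j<k : j < k) → edgeAt E j ≡ true → fromℕ< j<k ∈ E
edgeAt⇒∈ {E = E} j<k e =
  lookup⇒[]= _ E (trans (sym (edgeAt-toℕ E _)) (trans (cong (edgeAt E) (toℕ-fromℕ< j<k)) e))

∉⇒edgeAt : ∀ {k} {E : Subset k} {j} (j<k : j < k) → fromℕ< j<k ∉ E → edgeAt E j ≡ false
∉⇒edgeAt j<k i∉E = ¬-not λ e → i∉E (edgeAt⇒∈ j<k e)

lookup-interval : ∀ {k} a b (v : Fin (suc k)) → lookup (interval a b) v ≡ (a ≤ᵇ toℕ v) ∧ (toℕ v ≤ᵇ b)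
lookup-interval a b = lookup∘tabulate λ v → (a ≤ᵇ toℕ v) ∧ (toℕ v ≤ᵇ b)

∈-interval⁻ : ∀ {k} a b {v : Fin (suc k)} → v ∈ interval a b → a ≤ toℕ v × toℕ v ≤ b
∈-interval⁻ a b {v} v∈ with Equivalence.to T-∧ (subst T (lookup-interval a b v) (∈⇒T v∈))
... | a≤v , v≤b = ≤ᵇ⇒≤ a _ a≤v , ≤ᵇ⇒≤ _ b v≤b

∈-interval⁺ : ∀ {k} a b {v : Fin (suc k)} → a ≤ toℕ v → toℕ v ≤ b → v ∈ interval a b
∈-interval⁺ a b {v} a≤v v≤b =
  T⇒∈ (subst T (sym (lookup-interval a b v)) (Equivalence.from T-∧ (≤⇒≤ᵇ a≤v , ≤⇒≤ᵇ v≤b)))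

interval-⊆ : ∀ {k a b a′ b′} → a ≤ a′ → b′ ≤ b → interval {k} a′ b′ ⊆ interval a b
interval-⊆ {a = a} {b} {a′} {b′} a≤a′ b′≤b v∈ with ∈-interval⁻ a′ b′ v∈
... | a′≤v , v≤b′ = ∈-interval⁺ a b (≤-trans a≤a′ a′≤v) (≤-trans v≤b′ b′≤b)

-- IsComponent, with the edges indexed by ℕ.
record Run {k} (E : Subset k) (a b : ℕ) : Set where
  field
    a<b    : a < b
    b≤k    : b ≤ k
    inner  : ∀ {j} → a ≤ j → j < b → edgeAt E j ≡ true
    before : ∀ {j} → suc j ≡ a → edgeAt E j ≡ false
    after  : edgeAt E b ≡ false

  a<k : a < k
  a<k = <-≤-trans a<b b≤k

component⇒Run : ∀ {k} {E : Subset k} {C} → IsComponent E C → ∃₂ λ a b → Run E a b × C ≡ interval a b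
component⇒Run {k} {E} (a , b , a<b , b≤k , inner , before , after , C≡) = a , b , run , C≡
  where
  run : Run E a b
  run = record
    { a<b    = a<b
    ; b≤k    = b≤k
    ; inner  = λ {j} a≤j j<b →
        let j<k = <-≤-trans j<b b≤k ; j≡ = sym (toℕ-fromℕ< j<k) in
        trans (cong (edgeAt E) j≡) (∈⇒edgeAt (inner (fromℕ< j<k) (subst (a ≤_) j≡ a≤j) (subst (_< b) j≡ j<b)))
    ; before = λ {j} 1+j≡a →
        let j<k = <-≤-trans (<-trans (≤-reflexive 1+j≡a) a<b) b≤k in
        ∉⇒edgeAt j<k (before (fromℕ< j<k) (trans (cong suc (toℕ-fromℕ< j<k)) 1+j≡a))
    ; after  = [ (λ b<k → ∉⇒edgeAt b<k (after (fromℕ< b<k) (toℕ-fromℕ< b<k)))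
               , (λ b≡k → edgeAt-≥ E (≤-reflexive (sym b≡k))) ]′ (m≤n⇒m<n∨m≡n b≤k)
    }

Run⇒component : ∀ {k} {E : Subset k} {a b} → Run E a b → IsComponent E (interval a b)
Run⇒component {E = E} {a} {b} r = a , b , a<b , b≤k ,
  (λ i a≤i i<b → lookup⇒[]= i E (trans (sym (edgeAt-toℕ E i)) (inner a≤i i<b))) ,
  (λ i 1+i≡a → edgeAt⇒∉ (before 1+i≡a)) ,
  (λ i i≡b → edgeAt⇒∉ (subst (λ j → edgeAt E j ≡ false) (sym i≡b) after)) ,
  refl
  where open Run r

Run-unique : ∀ {k} {E : Subset k} {a b b′} → Run E a b → Run E a b′ → b ≡ b′
Run-unique r r′ = ≤-antisym (ends-before r r′) (ends-before r′ r)
  where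
  ends-before : ∀ {k} {E : Subset k} {a b b′} → Run E a b → Run E a b′ → b ≤ b′
  ends-before r r′ = ≮⇒≥ λ b′<b →
    true≢false (trans (sym (Run.inner r (<⇒≤ (Run.a<b r′)) b′<b)) (Run.after r′))

Run-separated : ∀ {k} {E : Subset k} {a b a′ b′} → Run E a b → Run E a′ b′ → a < a′ → b < a′
Run-separated {a′ = suc j} r r′ (s≤s a≤j) = ≰⇒> λ 1+j≤b →
  true≢false (trans (sym (Run.inner r a≤j 1+j≤b)) (Run.before r′ refl))

Run-disjoint : ∀ {k} {E : Subset k} {a b a′ b′ x} → Run E a b → Run E a′ b′ → a ≢ a′ →
  a ≤ x → x ≤ b → a′ ≤ x → x ≤ b′ → ⊥
Run-disjoint {a = a} {a′ = a′} r r′ a≢a′ a≤x x≤b a′≤x x≤b′ with <-cmp a a′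
... | tri< a<a′ _ _ = <⇒≱ (Run-separated r r′ a<a′) (≤-trans a′≤x x≤b)
... | tri≈ _ a≡a′ _ = a≢a′ a≡a′
... | tri> _ _ a′<a = <⇒≱ (Run-separated r′ r a′<a) (≤-trans a≤x x≤b′)

components-disjoint : ∀ {k} {E : Subset k} {C D} →
  IsComponent E C → IsComponent E D → C ≢ D → Disjoint C D
components-disjoint c d C≢D v∈C v∈D with component⇒Run c | component⇒Run d
... | a , b , r , refl | a′ , b′ , r′ , refl =
  let (a≤v , v≤b) = ∈-interval⁻ a b v∈C ; (a′≤v , v≤b′) = ∈-interval⁻ a′ b′ v∈D in
  Run-disjoint r r′ (λ { refl → C≢D (cong (interval a) (Run-unique r r′)) }) a≤v v≤b a′≤v v≤b′

component-nonempty : ∀ {k} {E : Subset k} {C} → IsComponent E C → Nonempty C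
component-nonempty c with component⇒Run c
... | a , b , r , refl =
  fromℕ< a<1+k , ∈-interval⁺ a b (≤-reflexive (sym a≡)) (≤-trans (≤-reflexive a≡) (<⇒≤ (Run.a<b r)))
  where
  a<1+k = m<n⇒m<1+n (Run.a<k r)
  a≡ = toℕ-fromℕ< a<1+k

lookup-vertices : ∀ {k} (E : Subset k) v →
  lookup (vertices E) v ≡ any (λ i → lookup E i ∧ endpoint i v) (allFin k)
lookup-vertices {k} E = lookup∘tabulate λ v → any (λ i → lookup E i ∧ endpoint i v) (allFin k)

∈-vertices⁺ : ∀ {k} {E : Subset k} {i v} → i ∈ E → T (endpoint i v) → v ∈ vertices E
∈-vertices⁺ {E = E} {i} {v} i∈E ep = T⇒∈ (subst T (sym (lookup-vertices E v))
  (Any.any⁺ _ (Any.tabulate⁺ i (Equivalence.from T-∧ (∈⇒T i∈E , ep)))))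

∈-vertices⁻ : ∀ {k} {E : Subset k} {v} → v ∈ vertices E → ∃ λ i → i ∈ E × T (endpoint i v)
∈-vertices⁻ {k} {E} {v} v∈
  with Any.satisfied (Any.any⁻ _ (allFin k) (subst T (lookup-vertices E v) (∈⇒T v∈)))
... | i , t with Equivalence.to T-∧ t
... | i∈E , ep = i , T⇒∈ i∈E , ep

vertices-mono : ∀ {k} {G H : Subset k} → G ⊆ H → vertices G ⊆ vertices H
vertices-mono G⊆H v∈ with ∈-vertices⁻ v∈
... | i , i∈G , ep = ∈-vertices⁺ (G⊆H i∈G) ep

endpoint-start : ∀ {k} {i : Fin k} {v : Fin (suc k)} → toℕ v ≡ toℕ i → T (endpoint i v)
endpoint-start v≡i = Equivalence.from T-∨ (inj₁ (≡⇒≡ᵇ _ _ v≡i))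

endpoint-end : ∀ {k} {i : Fin k} {v : Fin (suc k)} → toℕ v ≡ suc (toℕ i) → T (endpoint i v)
endpoint-end v≡1+i = Equivalence.from T-∨ (inj₂ (≡⇒≡ᵇ _ _ v≡1+i))

endpoint⁻ : ∀ {k} {i : Fin k} {v : Fin (suc k)} → T (endpoint i v) → toℕ v ≡ toℕ i ⊎ toℕ v ≡ suc (toℕ i)
endpoint⁻ t = Sum.map (≡ᵇ⇒≡ _ _) (≡ᵇ⇒≡ _ _) (Equivalence.to T-∨ t)

Run⇒interval⊆vertices : ∀ {k} {E : Subset k} {a b} → Run E a b → interval a b ⊆ vertices E
Run⇒interval⊆vertices {E = E} {a} {b} r {v} v∈ with ∈-interval⁻ a b v∈
... | a≤v , v≤b with m≤n⇒m<n∨m≡n v≤b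
...   | inj₁ v<b =
  ∈-vertices⁺ (edgeAt⇒∈ {E = E} v<k (inner a≤v v<b)) (endpoint-start {v = v} (sym (toℕ-fromℕ< v<k)))
  where
  open Run r
  v<k = <-≤-trans v<b b≤k
...   | inj₂ v≡b = last-vertex v v≡b
  where
  open Run r
  last-vertex : ∀ v → toℕ v ≡ b → v ∈ vertices E
  last-vertex zero    0≡b   = contradiction (subst (a <_) (sym 0≡b) a<b) λ ()
  last-vertex (suc w) 1+w≡b = ∈-vertices⁺ w∈E (endpoint-end {i = w} {v = suc w} refl)
    where
    w∈E = lookup⇒[]= w E (trans (sym (edgeAt-toℕ E w))
      (inner (≤-pred (subst (a <_) (sym 1+w≡b) a<b)) (≤-reflexive 1+w≡b)))

component⊆vertices : ∀ {k} {E : Subset k} {C} → IsComponent E C → C ⊆ vertices E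
component⊆vertices c with component⇒Run c
... | a , b , r , refl = Run⇒interval⊆vertices r

-- The first edges of the maximal runs of E; prev says whether the edge preceding E is present.
runStarts : ∀ {m} → Bool → Subset m → Subset m
runStarts prev []      = []
runStarts prev (s ∷ E) = (s ∧ not prev) ∷ runStarts s E

∣runStarts∣≡runs : ∀ {m} prev (E : Subset m) → ∣ runStarts prev E ∣ ≡ runs prev E
∣runStarts∣≡runs prev  []          = refl
∣runStarts∣≡runs false (false ∷ E) = ∣runStarts∣≡runs false E
∣runStarts∣≡runs false (true  ∷ E) = cong suc (∣runStarts∣≡runs true E)
∣runStarts∣≡runs true  (false ∷ E) = ∣runStarts∣≡runs false E
∣runStarts∣≡runs true  (true  ∷ E) = ∣runStarts∣≡runs true E

edgeAt-runStarts : ∀ {m} prev (E : Subset m) j →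
  edgeAt (runStarts prev E) j ≡ edgeAt E j ∧ not (edgeAt (prev ∷ E) j)
edgeAt-runStarts prev []      j       = refl
edgeAt-runStarts prev (s ∷ E) zero    = refl
edgeAt-runStarts prev (s ∷ E) (suc j) = edgeAt-runStarts s E j

Run⇒edgeAt-runStarts : ∀ {k} {E : Subset k} {a b} → Run E a b → edgeAt (runStarts false E) a ≡ true
Run⇒edgeAt-runStarts {E = E} {a} r =
  trans (edgeAt-runStarts false E a) (cong₂ (λ x y → x ∧ not y) (inner ≤-refl a<b) (off-before a refl))
  where
  open Run r
  off-before : ∀ x → x ≡ a → edgeAt (false ∷ E) x ≡ false
  off-before zero    _     = refl
  off-before (suc j) 1+j≡a = before 1+j≡a

distinct-components-length≤c : ∀ {k} {E : Subset k} {Ds} →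
  All (IsComponent E) Ds → AllPairs _≢_ Ds → length Ds ≤ c E
distinct-components-length≤c {E = E} comps distinct = ≤-trans
  (length≤∣p∣ StartsAt starts-unique (All.map label comps) distinct)
  (≤-reflexive (∣runStarts∣≡runs false E))
  where
  StartsAt : Subset _ → Fin _ → Set
  StartsAt D i = ∃ λ b → Run E (toℕ i) b × D ≡ interval (toℕ i) b
  starts-unique : ∀ {D D′ i} → StartsAt D i → StartsAt D′ i → D ≡ D′
  starts-unique {i = i} (b , r , refl) (b′ , r′ , refl) = cong (interval (toℕ i)) (Run-unique r r′)
  label : ∀ {D} → IsComponent E D → ∃ λ i → i ∈ runStarts false E × StartsAt D i
  label c with component⇒Run c
  ... | a , b , r , D≡ = fromℕ< (Run.a<k r) , edgeAt⇒∈ (Run.a<k r) (Run⇒edgeAt-runStarts r) ,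
    b , subst (λ x → Run E x b) a≡ r , trans D≡ (cong (λ x → interval x b) a≡)
    where a≡ = sym (toℕ-fromℕ< (Run.a<k r))

-- Components of G ∪ H

first-true : (P : ℕ → Bool) (lo hi : ℕ) →
  (∀ {j} → lo ≤ j → j < hi → P j ≡ false) ⊎
  (∃ λ j → lo ≤ j × j < hi × P j ≡ true × (∀ {j′} → lo ≤ j′ → j′ < j → P j′ ≡ false))
first-true P lo zero     = inj₁ λ _ ()
first-true P lo (suc hi) with first-true P lo hi
... | inj₂ (j , lo≤j , j<hi , Pj , none-before) = inj₂ (j , lo≤j , m<n⇒m<1+n j<hi , Pj , none-before)
... | inj₁ none with lo ≤? hi | P hi in Phi
...   | yes lo≤hi | true  = inj₂ (hi , lo≤hi , n<1+n hi , Phi , none)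
...   | yes _     | false = inj₁ λ lo≤j j<1+hi →
          [ none lo≤j , (λ { refl → Phi }) ]′ (m<1+n⇒m<n∨m≡n j<1+hi)
...   | no lo≰hi  | _     = inj₁ λ lo≤j j<1+hi →
          none lo≤j (≤∧≢⇒< (≤-pred j<1+hi) λ { refl → lo≰hi lo≤j })

EdgeFree : ∀ {k} → Subset k → ℕ → ℕ → Set
EdgeFree E a b = ∀ {j} → a ≤ j → j < b → edgeAt E j ≡ false

module _ {k} {G H : Subset k} where

  edgeAt-∪-falseˡ : ∀ {j} → edgeAt (G ∪ H) j ≡ false → edgeAt G j ≡ false
  edgeAt-∪-falseˡ {j} e = ∨-conicalˡ _ _ (trans (sym (edgeAt-∪ G H j)) e)

  edgeAt-∪-falseʳ : ∀ {j} → edgeAt (G ∪ H) j ≡ false → edgeAt H j ≡ false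
  edgeAt-∪-falseʳ {j} e = ∨-conicalʳ _ _ (trans (sym (edgeAt-∪ G H j)) e)

  G-run-from : ∀ {a b i} → Run (G ∪ H) a b → a ≤ i → i < b → edgeAt G i ≡ true → EdgeFree G a i →
    ∃ λ b′ → Run G i b′ × b′ ≤ b
  G-run-from {a} {b} {i} r a≤i i<b G∋i G-free with first-true (not ∘ edgeAt G) (suc i) (suc b)
  ... | inj₁ none =
    contradiction (trans (sym (cong not (edgeAt-∪-falseˡ (Run.after r)))) (none i<b (n<1+n b))) true≢false
  ... | inj₂ (b′ , i<b′ , b′<1+b , G∌b′ , G∋between) = b′ , run , ≤-pred b′<1+b
    where
    edge-before : ∀ j → suc j ≡ i → edgeAt G j ≡ false
    edge-before j 1+j≡i with a ≤? j
    ... | yes a≤j = G-free a≤j (≤-reflexive 1+j≡i)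
    ... | no  a≰j = edgeAt-∪-falseˡ (Run.before r (≤-antisym (≰⇒> a≰j) (subst (a ≤_) (sym 1+j≡i) a≤i)))
    run : Run G i b′
    run = record
      { a<b    = i<b′
      ; b≤k    = ≤-trans (≤-pred b′<1+b) (Run.b≤k r)
      ; inner  = λ i≤j j<b′ →
          [ (λ i<j → not-injective (G∋between i<j j<b′)) , (λ { refl → G∋i }) ]′ (m≤n⇒m<n∨m≡n i≤j)
      ; before = λ {j} → edge-before j
      ; after  = not-injective G∌b′
      }

  Run-∪-cases : ∀ {a b} → Run (G ∪ H) a b → (∃₂ λ a′ b′ → Run G a′ b′ × a ≤ a′ × b′ ≤ b) ⊎ EdgeFree G a b
  Run-∪-cases {a} {b} r with first-true (edgeAt G) a b
  ... | inj₁ G-free = inj₂ G-free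
  ... | inj₂ (i , a≤i , i<b , G∋i , G-free) with G-run-from r a≤i i<b G∋i G-free
  ...   | b′ , r′ , b′≤b = inj₁ (i , b′ , r′ , a≤i , b′≤b)

  EdgeFree-G⇒Run-H : ∀ {a b} → Run (G ∪ H) a b → EdgeFree G a b → Run H a b
  EdgeFree-G⇒Run-H {a} {b} r G-free = record
    { a<b    = a<b
    ; b≤k    = b≤k
    ; inner  = λ {j} a≤j j<b →
        trans (cong (_∨ edgeAt H j) (sym (G-free a≤j j<b))) (trans (sym (edgeAt-∪ G H j)) (inner a≤j j<b))
    ; before = edgeAt-∪-falseʳ ∘ before
    ; after  = edgeAt-∪-falseʳ after
    }
    where open Run r

  EdgeFree-G⇒Disjoint-vertices : ∀ {a b} → Run (G ∪ H) a b → EdgeFree G a b →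
    Disjoint (interval a b) (vertices G)
  EdgeFree-G⇒Disjoint-vertices {a} {b} r G-free {v} v∈ v∈VG
    with ∈-vertices⁻ {E = G} v∈VG | ∈-interval⁻ a b v∈
  ... | i , i∈G , ep | a≤v , v≤b = true≢false (trans (sym (∈⇒edgeAt i∈G)) (edge-near-v (endpoint⁻ ep)))
    where
    edge-near : ∀ {j} → a ≤ suc j → j ≤ b → edgeAt G j ≡ false
    edge-near {j} a≤1+j j≤b with m≤n⇒m<n∨m≡n j≤b | a ≤? j
    ... | inj₁ j<b  | yes a≤j = G-free a≤j j<b
    ... | inj₁ j<b  | no a≰j  = edgeAt-∪-falseˡ (Run.before r (≤-antisym (≰⇒> a≰j) a≤1+j))
    ... | inj₂ refl | _       = edgeAt-∪-falseˡ (Run.after r)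
    edge-near-v : toℕ v ≡ toℕ i ⊎ toℕ v ≡ suc (toℕ i) → edgeAt G (toℕ i) ≡ false
    edge-near-v (inj₁ v≡i)   = edge-near (m≤n⇒m≤1+n (subst (a ≤_) v≡i a≤v)) (subst (_≤ b) v≡i v≤b)
    edge-near-v (inj₂ v≡1+i) = edge-near (subst (a ≤_) v≡1+i a≤v) (≤-trans (n≤1+n _) (subst (_≤ b) v≡1+i v≤b))

  component-∪-cases : ∀ {C} → IsComponent (G ∪ H) C →
    (∃ λ D → IsComponent G D × D ⊆ C) ⊎ (IsComponent H C × Disjoint C (vertices G))
  component-∪-cases c with component⇒Run c
  ... | a , b , r , refl with Run-∪-cases r
  ...   | inj₁ (a′ , b′ , r′ , a≤a′ , b′≤b) = inj₁ (interval a′ b′ , Run⇒component r′ , interval-⊆ a≤a′ b′≤b)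
  ...   | inj₂ G-free =
    inj₂ (Run⇒component (EdgeFree-G⇒Run-H r G-free) , EdgeFree-G⇒Disjoint-vertices r G-free)

record ComponentSplit {k} (G H : Subset k) (Cs : List (Subset (suc k))) : Set where
  field
    Gs Hs          : List (Subset (suc k))
    Gs-components  : All (IsComponent G) Gs
    Hs-components  : All (IsComponent H) Hs
    Gs-distinct    : AllPairs _≢_ Gs
    Hs-distinct    : AllPairs _≢_ Hs
    length-+       : length Gs + length Hs ≡ length Cs
    ⋃Gs⊆⋃Cs        : ⋃ Gs ⊆ ⋃ Cs
    ⋃Hs⊆⋃Cs        : ⋃ Hs ⊆ ⋃ Cs
    ⋃Gs⊆vertices   : ⋃ Gs ⊆ vertices G
    ⋃Hs∩vertices=∅ : Disjoint (⋃ Hs) (vertices G)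

module _ {k} {G H : Subset k} where

  private
    consG : ∀ {C D Cs} → IsComponent G D → D ⊆ C → Disjoint C (⋃ Cs) →
      ComponentSplit G H Cs → ComponentSplit G H (C ∷ Cs)
    consG {C} {D} {Cs} d D⊆C C∩⋃Cs=∅ split = record
      { Gs             = D ∷ Gs
      ; Hs             = Hs
      ; Gs-components  = d ∷ Gs-components
      ; Hs-components  = Hs-components
      ; Gs-distinct    = Disjoint-⋃⇒distinct (component-nonempty d)
                           (λ x∈D x∈⋃Gs → C∩⋃Cs=∅ (D⊆C x∈D) (⋃Gs⊆⋃Cs x∈⋃Gs)) ∷ Gs-distinct
      ; Hs-distinct    = Hs-distinct
      ; length-+       = cong suc length-+
      ; ⋃Gs⊆⋃Cs        = ∪-mono-⊆ D⊆C ⋃Gs⊆⋃Cs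
      ; ⋃Hs⊆⋃Cs        = λ x∈⋃Hs → q⊆p∪q C (⋃ Cs) (⋃Hs⊆⋃Cs x∈⋃Hs)
      ; ⋃Gs⊆vertices   = ∪-⊆ (component⊆vertices d) ⋃Gs⊆vertices
      ; ⋃Hs∩vertices=∅ = ⋃Hs∩vertices=∅
      }
      where open ComponentSplit split

    consH : ∀ {C Cs} → IsComponent H C → Disjoint C (vertices G) → Disjoint C (⋃ Cs) →
      ComponentSplit G H Cs → ComponentSplit G H (C ∷ Cs)
    consH {C} {Cs} h C∩VG=∅ C∩⋃Cs=∅ split = record
      { Gs             = Gs
      ; Hs             = C ∷ Hs
      ; Gs-components  = Gs-components
      ; Hs-components  = h ∷ Hs-components
      ; Gs-distinct    = Gs-distinct
      ; Hs-distinct    = Disjoint-⋃⇒distinct (component-nonempty h)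
                           (λ x∈C x∈⋃Hs → C∩⋃Cs=∅ x∈C (⋃Hs⊆⋃Cs x∈⋃Hs)) ∷ Hs-distinct
      ; length-+       = trans (+-suc (length Gs) (length Hs)) (cong suc length-+)
      ; ⋃Gs⊆⋃Cs        = λ x∈⋃Gs → q⊆p∪q C (⋃ Cs) (⋃Gs⊆⋃Cs x∈⋃Gs)
      ; ⋃Hs⊆⋃Cs        = ∪-mono-⊆ (λ x∈C → x∈C) ⋃Hs⊆⋃Cs
      ; ⋃Gs⊆vertices   = ⋃Gs⊆vertices
      ; ⋃Hs∩vertices=∅ = ∪-Disjoint C∩VG=∅ ⋃Hs∩vertices=∅
      }
      where open ComponentSplit split

  split-components : ∀ {Cs} → All (IsComponent (G ∪ H)) Cs → AllPairs _≢_ Cs → ComponentSplit G H Cs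
  split-components [] [] = record
    { Gs             = []
    ; Hs             = []
    ; Gs-components  = []
    ; Hs-components  = []
    ; Gs-distinct    = []
    ; Hs-distinct    = []
    ; length-+       = refl
    ; ⋃Gs⊆⋃Cs        = λ x∈⊥ → x∈⊥
    ; ⋃Hs⊆⋃Cs        = λ x∈⊥ → x∈⊥
    ; ⋃Gs⊆vertices   = λ x∈⊥ → contradiction x∈⊥ ∉⊥
    ; ⋃Hs∩vertices=∅ = λ x∈⊥ _ → ∉⊥ x∈⊥
    }
  split-components {C ∷ Cs} (c ∷ cs) (C≢Cs ∷ distinct) =
    [ (λ (D , d , D⊆C) → consG d D⊆C C∩⋃Cs=∅ split)
    , (λ (h , C∩VG=∅) → consH h C∩VG=∅ C∩⋃Cs=∅ split)
    ]′ (component-∪-cases c)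
    where
    split = split-components cs distinct
    C∩⋃Cs=∅ : Disjoint C (⋃ Cs)
    C∩⋃Cs=∅ = Disjoint-⋃
      (All.zipWith {R = Disjoint C} (λ (C≢D , d) → components-disjoint c d C≢D) (C≢Cs , cs))

-- Joins of small pathsets

DependsOn⇒Extensional : ∀ {n k} {V} {A : Asg n k → Bool} → DependsOn V A → Extensional A
DependsOn⇒Extensional dA x≗y = dA _ _ λ v _ → x≗y v

DependsOn-⊆ : ∀ {n k} {V W} {A : Asg n k → Bool} → V ⊆ W → DependsOn V A → DependsOn W A
DependsOn-⊆ V⊆W dA x y agree = dA x y λ v v∈V → agree v (V⊆W v∈V)

join-DependsOn : ∀ {n k} {V} {A B : Asg n k → Bool} →
  DependsOn V A → DependsOn V B → DependsOn V (join A B)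
join-DependsOn dA dB x y agree = cong₂ _∧_ (dA x y agree) (dB x y agree)

module _ {n k : ℕ} where

  fiberSize-congʷ : ∀ {A : Asg n k → Bool} → Extensional A → ∀ S → Extensional (fiberSize A S)
  fiberSize-congʷ {A} A-ext S {w} {w′} w≗w′ = begin
    fiberSize A S w                ≡⟨ fiberSize≡fiberSum A A-ext S w ⟩
    fiberSum S w (indicator ∘ A)   ≡⟨ fiberSum-congʷ S (indicator ∘ A) w≗w′ ⟩
    fiberSum S w′ (indicator ∘ A)  ≡⟨ fiberSize≡fiberSum A A-ext S w′ ⟨
    fiberSize A S w′               ∎
    where open ≡-Reasoning

  fiberSize≤n^∣S∣ : ∀ {A : Asg n k → Bool} → Extensional A → ∀ S w → fiberSize A S w ≤ n ^ ∣ S ∣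
  fiberSize≤n^∣S∣ {A} A-ext S w = begin
    fiberSize A S w               ≡⟨ fiberSize≡fiberSum A A-ext S w ⟩
    fiberSum S w (indicator ∘ A)  ≤⟨ fiberSum-mono S w (λ x _ → indicator≤1 (A x)) ⟩
    fiberSum S w (const 1)        ≡⟨ fiberSum-const S w 1 ⟩
    n ^ ∣ S ∣ * 1                 ≡⟨ *-identityʳ _ ⟩
    n ^ ∣ S ∣                     ∎
    where
    open ≤-Reasoning
    indicator≤1 : ∀ b → indicator b ≤ 1
    indicator≤1 true  = ≤-refl
    indicator≤1 false = z≤n

  record FiberBound (A : Asg n k → Bool) (S : Subset (suc k)) (t : ℕ) : Set where
    field
      μ           : ℕ
      fiberSize≤μ : ∀ w → fiberSize A S w ≤ μ
      μ-bounded   : BoundLe n k ∣ S ∣ t μ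

  -- Small bounds every fiber separately; the largest one inherits the bound as it is one of
  -- them, or 0 if there are none.
  small-FiberBound : ∀ {G : PatternGraph k} {A Ds} → 1 ≤ n → DependsOn (vertices G) A → Small n k G A →
    All (IsComponent G) Ds → AllPairs _≢_ Ds → FiberBound A (⋃ Ds) (length Ds)
  small-FiberBound n≥1 dA sA [] [] = record
    { μ           = n ^ ∣ ⋃ {suc k} [] ∣
    ; fiberSize≤μ = fiberSize≤n^∣S∣ (DependsOn⇒Extensional dA) (⋃ [])
    ; μ-bounded   = BoundLe-n^s n k ∣ ⋃ {suc k} [] ∣
    }
  small-FiberBound {A = A} {Ds} n≥1 dA sA comps@(_ ∷ _) distinct = record
    { μ           = maxOver (fiberSize A (⋃ Ds))
    ; fiberSize≤μ = ≤maxOver _ (fiberSize-congʷ (DependsOn⇒Extensional dA) (⋃ Ds))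
    ; μ-bounded   = maxOver-all (BoundLe n k ∣ ⋃ Ds ∣ (length Ds)) _ (BoundLe-0 k ∣ ⋃ Ds ∣ (length Ds) n≥1)
        (sA (length Ds) (s≤s z≤n) (distinct-components-length≤c comps distinct) (⋃ Ds)
            (Ds , refl , comps , distinct , refl))
    }

  -- On a fiber over S₂ the value of A is constant, as A does not read S₂; so summing over S₂
  -- first factors out the indicator of A.
  fiberSize-join≤ : ∀ {V W} {A B : Asg n k → Bool} {R S₁ S₂ α β} →
    DependsOn V A → DependsOn W B → Disjoint S₂ V → Disjoint S₁ S₂ → Disjoint R (S₁ ∪ S₂) →
    (∀ u → fiberSize A S₁ u ≤ α) → (∀ u → fiberSize B S₂ u ≤ β) →
    ∀ w → fiberSize (join A B) (R ∪ (S₁ ∪ S₂)) w ≤ n ^ ∣ R ∣ * (α * β)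
  fiberSize-join≤ {A = A} {B} {R} {S₁} {S₂} {α} {β} dA dB S₂∩V=∅ S₁∩S₂=∅ R∩S₁₂=∅ A≤α B≤β w = begin
    fiberSize (join A B) (R ∪ (S₁ ∪ S₂)) w
      ≡⟨ fiberSize≡fiberSum (join A B) (λ x≗y → cong₂ _∧_ (A-ext x≗y) (B-ext x≗y)) (R ∪ (S₁ ∪ S₂)) w ⟩
    fiberSum (R ∪ (S₁ ∪ S₂)) w [A∧B]
      ≡⟨ fiberSum-∪ R (S₁ ∪ S₂) w [A∧B] R∩S₁₂=∅ ⟩
    fiberSum R w (λ u → fiberSum (S₁ ∪ S₂) u [A∧B])
      ≡⟨ fiberSum-cong R w (λ u _ → fiberSum-∪ S₁ S₂ u [A∧B] S₁∩S₂=∅) ⟩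
    fiberSum R w (λ u → fiberSum S₁ u (λ u₁ → fiberSum S₂ u₁ [A∧B]))
      ≤⟨ fiberSum-mono R w (λ u _ → fiberSum-mono S₁ u λ u₁ _ → sum-over-S₂ u₁) ⟩
    fiberSum R w (λ u → fiberSum S₁ u (λ u₁ → β * indicator (A u₁)))
      ≡⟨ fiberSum-cong R w (λ u _ → fiberSum-*ˡ S₁ u β (indicator ∘ A)) ⟩
    fiberSum R w (λ u → β * fiberSum S₁ u (indicator ∘ A))
      ≤⟨ fiberSum-mono R w (λ u _ → *-monoʳ-≤ β
           (≤-trans (≤-reflexive (sym (fiberSize≡fiberSum A A-ext S₁ u))) (A≤α u))) ⟩
    fiberSum R w (const (β * α))
      ≡⟨ fiberSum-const R w (β * α) ⟩
    n ^ ∣ R ∣ * (β * α)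
      ≡⟨ cong (n ^ ∣ R ∣ *_) (*-comm β α) ⟩
    n ^ ∣ R ∣ * (α * β) ∎
    where
    open ≤-Reasoning
    A-ext = DependsOn⇒Extensional dA
    B-ext = DependsOn⇒Extensional dB
    [A∧B] : Asg n k → ℕ
    [A∧B] = indicator ∘ join A B
    sum-over-S₂ : ∀ u₁ → fiberSum S₂ u₁ [A∧B] ≤ β * indicator (A u₁)
    sum-over-S₂ u₁ = begin
      fiberSum S₂ u₁ [A∧B]
        ≡⟨ fiberSum-cong S₂ u₁ (λ x agree → trans
             (cong (λ a → indicator (a ∧ B x)) (dA x u₁ λ v v∈V → agree λ v∈S₂ → S₂∩V=∅ v∈S₂ v∈V))
             (indicator-∧ (A u₁) (B x))) ⟩
      fiberSum S₂ u₁ (λ x → indicator (A u₁) * indicator (B x))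
        ≡⟨ fiberSum-*ˡ S₂ u₁ (indicator (A u₁)) (indicator ∘ B) ⟩
      indicator (A u₁) * fiberSum S₂ u₁ (indicator ∘ B)
        ≡⟨ cong (indicator (A u₁) *_) (fiberSize≡fiberSum B B-ext S₂ u₁) ⟨
      indicator (A u₁) * fiberSize B S₂ u₁
        ≤⟨ *-monoʳ-≤ (indicator (A u₁)) (B≤β u₁) ⟩
      indicator (A u₁) * β
        ≡⟨ *-comm (indicator (A u₁)) β ⟩
      β * indicator (A u₁) ∎

  join-Small : ∀ (G H : PatternGraph k) (A B : Asg n k → Bool) → 1 ≤ n →
    DependsOn (vertices G) A → Small n k G A → DependsOn (vertices H) B → Small n k H B →
    Small n k (G ∪G H) (join A B)
  join-Small G H A B n≥1 dA sA dB sB t _ _ S (Cs , refl , comps , distinct , refl) w =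
    subst₂ (λ s t → BoundLe n k s t (fiberSize (join A B) (⋃ Cs) w)) ∣R∣+∣S₁₂∣≡∣S∣ length-+
      (BoundLe-* {r = ∣ R ∣} {∣ ⋃ Gs ∣} {∣ ⋃ Hs ∣} {length Gs} {length Hs} count α-bounded β-bounded)
    where
    open ComponentSplit (split-components comps distinct)
    open FiberBound (small-FiberBound n≥1 dA sA Gs-components Gs-distinct)
      renaming (μ to α; fiberSize≤μ to A≤α; μ-bounded to α-bounded)
    open FiberBound (small-FiberBound n≥1 dB sB Hs-components Hs-distinct)
      renaming (μ to β; fiberSize≤μ to B≤β; μ-bounded to β-bounded)
    S₁₂ = ⋃ Gs ∪ ⋃ Hs
    R   = ⋃ Cs ─ S₁₂
    Gs∩Hs=∅ : Disjoint (⋃ Gs) (⋃ Hs)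
    Gs∩Hs=∅ x∈⋃Gs x∈⋃Hs = ⋃Hs∩vertices=∅ x∈⋃Hs (⋃Gs⊆vertices x∈⋃Gs)
    R∪S₁₂≡S : R ∪ S₁₂ ≡ ⋃ Cs
    R∪S₁₂≡S = ─-∪ (∪-⊆ ⋃Gs⊆⋃Cs ⋃Hs⊆⋃Cs)
    count : fiberSize (join A B) (⋃ Cs) w ≤ n ^ ∣ R ∣ * (α * β)
    count = subst (λ S → fiberSize (join A B) S w ≤ n ^ ∣ R ∣ * (α * β)) R∪S₁₂≡S
      (fiberSize-join≤ {R = R} {⋃ Gs} {⋃ Hs} dA dB ⋃Hs∩vertices=∅ Gs∩Hs=∅ (─-Disjoint (⋃ Cs) S₁₂) A≤α B≤β w)
    ∣R∣+∣S₁₂∣≡∣S∣ : ∣ R ∣ + (∣ ⋃ Gs ∣ + ∣ ⋃ Hs ∣) ≡ ∣ ⋃ Cs ∣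
    ∣R∣+∣S₁₂∣≡∣S∣ = begin
      ∣ R ∣ + (∣ ⋃ Gs ∣ + ∣ ⋃ Hs ∣)  ≡⟨ cong (∣ R ∣ +_) (∣p∪q∣≡∣p∣+∣q∣ (⋃ Gs) (⋃ Hs) Gs∩Hs=∅) ⟨
      ∣ R ∣ + ∣ S₁₂ ∣                ≡⟨ ∣p∪q∣≡∣p∣+∣q∣ R S₁₂ (─-Disjoint (⋃ Cs) S₁₂) ⟨
      ∣ R ∪ S₁₂ ∣                    ≡⟨ cong ∣_∣ R∪S₁₂≡S ⟩
      ∣ ⋃ Cs ∣                       ∎
      where open ≡-Reasoning

lemma5p5 : (n k : ℕ) → 1 ≤ n → 2 ≤ k →
    (G H : PatternGraph k) (A B : Asg n k → Bool) →
    DependsOn (vertices G) A → Small n k G A →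
    DependsOn (vertices H) B → Small n k H B →
    DependsOn (vertices (G ∪G H)) (join A B) × Small n k (G ∪G H) (join A B)
lemma5p5 n k n≥1 _ G H A B dA sA dB sB =
  join-DependsOn (DependsOn-⊆ (vertices-mono (p⊆p∪q {p = G} H)) dA)
                 (DependsOn-⊆ (vertices-mono (q⊆p∪q G H)) dB) ,
  join-Small G H A B n≥1 dA sA dB sB
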